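{- For every integer $q>1$, the sequence $\lceil n/q\rceil$ formally satisfies the recursion $$R(n)=\sum_{i=0}^{q-1}R\Big(n-i-\sum_{j=1}^{q-1}R(n-j)\Big).$$
   Context: A sequence $B$ formally satisfies a recursion if for every $n$, replacing every occurrence of $R$ by $B$ (with $B(m)=\lceil m/q\rceil$ for all integers $m$) yields a true equality. -}

module Defs where

open import Data.Nat as ℕ using (ℕ; zero; suc; NonZero)
open import Data.Integer using (ℤ; +_; -_; _+_; _-_; _/ℕ_)

-- Ceiling of m / q for an integer m and positive natural q:
-- ⌈m/q⌉ = - ⌊(-m)/q⌋, where _/ℕ_ is floor division in the stdlib.
ceilDiv : ℤ → (q : ℕ) → .{{NonZero q}} → ℤ
ceilDiv m q = - ((- m) /ℕ q)

sumFrom : ℕ → ℕ → (ℕ → ℤ) → ℤ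
sumFrom a zero    f = + 0
sumFrom a (suc k) f = f a + sumFrom (suc a) k f

module Submission where

-- Write H m = ⌈m/q⌉ and S n = Σ_{j=1}^{q-1} H (n - j).  The proof rests on
-- Hermite's identity for the ceiling,
--
--     G m := Σ_{i=0}^{q-1} H (m - i) = m      for every integer m,
--
-- which holds for every q ≥ 1.  The right-hand side of the recursion is
-- G (n - S n) = n - S n, and Hermite's identity at m = n reads H n + S n = n;
-- hence the right-hand side equals H n.
--
-- Hermite's identity is proved by integer induction: G 0 = 0 because every
-- term H (-i) with 0 ≤ i < q vanishes, and G (m + 1) = G m + 1 because
-- shifting m by one removes the term H (m - (q-1)) and adds H (m + 1),
-- which is exactly one larger (H (m + q) = H m + 1).

open import Defs
open import Data.Nat as ℕ using (ℕ; NonZero; _>_)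
open import Data.Integer using (ℤ; +_; _-_)
open import Relation.Binary.PropositionalEquality using (_≡_)

open import Data.Integer as ℤ using (_+_; _*_; -_; -[1+_]; _/ℕ_; 0ℤ; 1ℤ; pred)
  renaming (suc to sucℤ)
import Data.Integer.Properties as ℤP
import Data.Nat.Properties as ℕP
open import Data.Integer.DivMod using ([n/ℕd]*d≤n; n<s[n/ℕd]*d)
open import Data.Integer.Tactic.RingSolver using (solve-∀)
open import Relation.Binary.PropositionalEquality
  using (refl; sym; trans; cong; cong₂; subst; module ≡-Reasoning)

<-suc⇒≤ : ∀ {i j} → i ℤ.< sucℤ j → i ℤ.≤ j
<-suc⇒≤ {i} {j} i<1+j = subst (i ℤ.≤_) (ℤP.pred-suc j) (ℤP.i<j⇒i≤pred[j] i<1+j)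

floor-unique : ∀ x d .{{_ : NonZero d}} (a : ℤ) →
               a * + d ℤ.≤ x → x ℤ.< sucℤ a * + d → x /ℕ d ≡ a
floor-unique x d a ad≤x x<[a+1]d = ℤP.≤-antisym ⌊x/d⌋≤a a≤⌊x/d⌋
  where
  ⌊x/d⌋≤a : x /ℕ d ℤ.≤ a
  ⌊x/d⌋≤a = <-suc⇒≤ (ℤP.*-cancelʳ-<-nonNeg (+ d) (ℤP.≤-<-trans ([n/ℕd]*d≤n x d) x<[a+1]d))
  a≤⌊x/d⌋ : a ℤ.≤ x /ℕ d
  a≤⌊x/d⌋ = <-suc⇒≤ (ℤP.*-cancelʳ-<-nonNeg (+ d) (ℤP.≤-<-trans ad≤x (n<s[n/ℕd]*d x d)))

floor-shift : ∀ x d .{{_ : NonZero d}} → (x + + d) /ℕ d ≡ sucℤ (x /ℕ d)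
floor-shift x d = floor-unique (x + + d) d (sucℤ b) lower upper
  where
  b = x /ℕ d
  suc-*-d : ∀ a → a * + d + + d ≡ sucℤ a * + d
  suc-*-d a = trans (ℤP.+-comm (a * + d) (+ d)) (sym (ℤP.suc-* a (+ d)))
  lower : sucℤ b * + d ℤ.≤ x + + d
  lower = subst (ℤ._≤ x + + d) (suc-*-d b) (ℤP.+-monoˡ-≤ (+ d) ([n/ℕd]*d≤n x d))
  upper : x + + d ℤ.< sucℤ (sucℤ b) * + d
  upper = subst (x + + d ℤ.<_) (suc-*-d (sucℤ b)) (ℤP.+-monoˡ-< (+ d) (n<s[n/ℕd]*d x d))

ceil-shift : ∀ m q .{{_ : NonZero q}} → ceilDiv m q ≡ ceilDiv (m - + q) q + 1ℤ
ceil-shift m q = sym (begin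
    - ((- (m - + q)) /ℕ q) + 1ℤ  ≡⟨ cong (λ y → - (y /ℕ q) + 1ℤ) (neg-minus m (+ q)) ⟩
    - ((- m + + q) /ℕ q) + 1ℤ    ≡⟨ cong (λ y → - y + 1ℤ) (floor-shift (- m) q) ⟩
    - sucℤ ((- m) /ℕ q) + 1ℤ     ≡⟨ neg-suc-plus-one ((- m) /ℕ q) ⟩
    - ((- m) /ℕ q)               ∎)
  where
  open ≡-Reasoning
  neg-minus : ∀ m k → - (m - k) ≡ - m + k
  neg-minus = solve-∀
  neg-suc-plus-one : ∀ y → - (1ℤ + y) + 1ℤ ≡ - y
  neg-suc-plus-one = solve-∀

ceil-small : ∀ q .{{_ : NonZero q}} i → i ℕ.< q → ceilDiv (0ℤ - + i) q ≡ 0ℤ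
ceil-small q i i<q = begin
    - ((- (0ℤ - + i)) /ℕ q)  ≡⟨ cong (λ y → - (y /ℕ q)) (neg-neg-minus (+ i)) ⟩
    - (+ i /ℕ q)             ≡⟨ cong -_ (floor-unique (+ i) q 0ℤ (ℤ.+≤+ ℕ.z≤n) i<1*q) ⟩
    0ℤ                       ∎
  where
  open ≡-Reasoning
  neg-neg-minus : ∀ x → - (0ℤ - x) ≡ x
  neg-neg-minus = solve-∀
  i<1*q : + i ℤ.< 1ℤ * + q
  i<1*q = subst (+ i ℤ.<_) (sym (ℤP.*-identityˡ (+ q))) (ℤ.+<+ i<q)

sumFrom-cong : ∀ a k {f g : ℕ → ℤ} → (∀ i → f i ≡ g i) → sumFrom a k f ≡ sumFrom a k g
sumFrom-cong a ℕ.zero    f≗g = refl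
sumFrom-cong a (ℕ.suc k) f≗g = cong₂ _+_ (f≗g a) (sumFrom-cong (ℕ.suc a) k f≗g)

sumFrom-suc : ∀ a k (f : ℕ → ℤ) → sumFrom (ℕ.suc a) k f ≡ sumFrom a k (λ i → f (ℕ.suc i))
sumFrom-suc a ℕ.zero    f = refl
sumFrom-suc a (ℕ.suc k) f = cong (λ y → f (ℕ.suc a) + y) (sumFrom-suc (ℕ.suc a) k f)

sumFrom-snoc : ∀ a k (f : ℕ → ℤ) → sumFrom a (ℕ.suc k) f ≡ sumFrom a k f + f (a ℕ.+ k)
sumFrom-snoc a ℕ.zero f = begin
    f a + 0ℤ  ≡⟨ ℤP.+-comm (f a) 0ℤ ⟩
    0ℤ + f a  ≡⟨ cong (λ i → 0ℤ + f i) (sym (ℕP.+-identityʳ a)) ⟩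
    0ℤ + f (a ℕ.+ 0) ∎
  where open ≡-Reasoning
sumFrom-snoc a (ℕ.suc k) f = begin
    f a + sumFrom (ℕ.suc a) (ℕ.suc k) f
      ≡⟨ cong (λ y → f a + y) (sumFrom-snoc (ℕ.suc a) k f) ⟩
    f a + (sumFrom (ℕ.suc a) k f + f (ℕ.suc a ℕ.+ k))
      ≡⟨ sym (ℤP.+-assoc (f a) _ _) ⟩
    (f a + sumFrom (ℕ.suc a) k f) + f (ℕ.suc a ℕ.+ k)
      ≡⟨ cong (λ i → (f a + sumFrom (ℕ.suc a) k f) + f i) (sym (ℕP.+-suc a k)) ⟩
    (f a + sumFrom (ℕ.suc a) k f) + f (a ℕ.+ ℕ.suc k) ∎
  where open ≡-Reasoning

sumFrom-zero : ∀ a k (f : ℕ → ℤ) → (∀ j → j ℕ.< a ℕ.+ k → f j ≡ 0ℤ) → sumFrom a k f ≡ 0ℤ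
sumFrom-zero a ℕ.zero    f vanish = refl
sumFrom-zero a (ℕ.suc k) f vanish =
  cong₂ _+_ (vanish a (ℕP.m<m+n a (ℕ.s≤s ℕ.z≤n)))
            (sumFrom-zero (ℕ.suc a) k f λ j j<1+a+k →
               vanish j (subst (j ℕ.<_) (sym (ℕP.+-suc a k)) j<1+a+k))

suc-equivariant⇒id : (f : ℤ → ℤ) → f 0ℤ ≡ 0ℤ → (∀ m → f (sucℤ m) ≡ sucℤ (f m)) →
                     ∀ m → f m ≡ m
suc-equivariant⇒id f f0 fsuc = on-ℤ
  where
  down : ∀ m → f (sucℤ m) ≡ sucℤ m → f m ≡ m
  down m f[1+m]≡1+m = begin
    f m               ≡⟨ sym (ℤP.pred-suc (f m)) ⟩
    pred (sucℤ (f m)) ≡⟨ cong pred (sym (fsuc m)) ⟩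
    pred (f (sucℤ m)) ≡⟨ cong pred f[1+m]≡1+m ⟩
    pred (sucℤ m)     ≡⟨ ℤP.pred-suc m ⟩
    m                 ∎
    where open ≡-Reasoning
  on-ℕ : ∀ n → f (+ n) ≡ + n
  on-ℕ ℕ.zero    = f0
  on-ℕ (ℕ.suc n) = trans (fsuc (+ n)) (cong sucℤ (on-ℕ n))
  on-neg : ∀ n → f -[1+ n ] ≡ -[1+ n ]
  on-neg ℕ.zero    = down -[1+ 0 ] f0
  on-neg (ℕ.suc n) = down -[1+ ℕ.suc n ] (on-neg n)
  on-ℤ : ∀ m → f m ≡ m
  on-ℤ (+ n)    = on-ℕ n
  on-ℤ -[1+ n ] = on-neg n

hermite-sum : (q : ℕ) → .{{_ : NonZero q}} → ℤ → ℤ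
hermite-sum q m = sumFrom 0 q (λ i → ceilDiv (m - + i) q)

hermite-sum-zero : ∀ q .{{_ : NonZero q}} → hermite-sum q 0ℤ ≡ 0ℤ
hermite-sum-zero q = sumFrom-zero 0 q _ (ceil-small q)

-- With q = p + 1, moving from m to m + 1 trades the term ⌈(m-p)/q⌉ for
-- ⌈(m+1)/q⌉ = ⌈(m-p)/q⌉ + 1 (ceil-shift).
hermite-sum-suc : ∀ q .{{_ : NonZero q}} m → hermite-sum q (sucℤ m) ≡ sucℤ (hermite-sum q m)
hermite-sum-suc (ℕ.suc p) m = begin
    H (1ℤ + m - + 0) + sumFrom 1 p (λ i → H (1ℤ + m - + i))
      ≡⟨ cong (λ y → H (1ℤ + m - + 0) + y) (trans (sumFrom-suc 0 p _) (sumFrom-cong 0 p λ i → cong H (minus-suc m (+ i)))) ⟩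
    H (1ℤ + m - + 0) + S
      ≡⟨ cong (λ y → y + S) (trans (ceil-shift (1ℤ + m - + 0) q) (cong (λ y → H y + 1ℤ) (minus-q m (+ p)))) ⟩
    (H (m - + p) + 1ℤ) + S
      ≡⟨ rearrange (H (m - + p)) S ⟩
    1ℤ + (S + H (m - + p))
      ≡⟨ cong (λ y → 1ℤ + y) (sym (sumFrom-snoc 0 p λ i → H (m - + i))) ⟩
    1ℤ + hermite-sum q m ∎
  where
  open ≡-Reasoning
  q = ℕ.suc p
  H : ℤ → ℤ
  H x = ceilDiv x q
  S = sumFrom 0 p (λ i → H (m - + i))
  minus-suc : ∀ m i → 1ℤ + m - (1ℤ + i) ≡ m - i
  minus-suc = solve-∀
  minus-q : ∀ m p → 1ℤ + m - 0ℤ - (1ℤ + p) ≡ m - p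
  minus-q = solve-∀
  rearrange : ∀ a s → (a + 1ℤ) + s ≡ 1ℤ + (s + a)
  rearrange = solve-∀

hermite : ∀ q .{{_ : NonZero q}} m → hermite-sum q m ≡ m
hermite q = suc-equivariant⇒id (hermite-sum q) (hermite-sum-zero q) (hermite-sum-suc q)

theorem6 : (q : ℕ) → .{{_ : NonZero q}} → q > 1 → (n : ℤ) →
    ceilDiv n q ≡
      sumFrom 0 q (λ i → ceilDiv ((n - + i) - sumFrom 1 (q ℕ.∸ 1) (λ j → ceilDiv (n - + j) q)) q)
theorem6 q@(ℕ.suc p) _ n = sym (begin
    sumFrom 0 q (λ i → H ((n - + i) - S))  ≡⟨ sumFrom-cong 0 q (λ i → cong H (swap n (+ i) S)) ⟩
    hermite-sum q (n - S)                 ≡⟨ hermite q (n - S) ⟩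
    n - S                                 ≡⟨ cong (λ y → y - S) (sym (hermite q n)) ⟩
    (H (n - + 0) + S) - S                 ≡⟨ cancel (H (n - + 0)) S ⟩
    H (n - + 0)                           ≡⟨ cong H (ℤP.+-identityʳ n) ⟩
    H n                                   ∎)
  where
  open ≡-Reasoning
  H : ℤ → ℤ
  H x = ceilDiv x q
  S = sumFrom 1 p (λ j → H (n - + j))
  swap : ∀ n i s → (n - i) - s ≡ (n - s) - i
  swap = solve-∀
  cancel : ∀ a s → (a + s) - s ≡ a
  cancel = solve-∀
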